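{- If $G\in\mathbb{Np}^\infty$ is a symmetric form, then $o(G)\in\{\mathscr N,\mathscr P\}$.
   Context: Affine normal play forms $\mathbb{Np}^\infty$ are defined recursively: two atomic forms $\infty$ and $\overline{\infty}$ with no options; every other form is $G=\{G^{\mathcal L}\mid G^{\mathcal R}\}$ with finite nonempty sets of previously constructed forms as Left and Right options. Outcomes: Left wins $\infty$ and Right wins $\overline{\infty}$ whoever moves; otherwise play alternates, Left moving first wins iff some Left option is won by Left moving second, Left moving second wins iff every Right option is won by Left moving first, symmetrically for Right. $o(G)$ is $\mathscr L$ (Left wins moving first and second), $\mathscr R$ (Right wins either way), $\mathscr N$ (first player wins), $\mathscr P$ (second player wins). Conjugate $\overline G$: $\overline\infty$ if $G=\infty$, $\infty$ if $G=\overline\infty$, otherwise $\{\overline{G^R}\mid\overline{G^L}\}$ (conjugating each option). $G$ is symmetric if $G\notin\{\infty,\overline\infty\}$ and $G^{\mathcal R}=\{\overline{G^L}:G^L\in G^{\mathcal L}\}$. -}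

module Defs where

open import Data.Bool using (Bool; true; false; not; _∧_; _∨_)
open import Data.List using (List; []; _∷_; map; any; all)
open import Data.List.Membership.Propositional using (_∈_)
open import Relation.Binary.PropositionalEquality using (_≡_)
open import Data.Product using (∃-syntax; _×_)

-- Affine normal play forms.  A compound form carries its Left and Right
-- options as lists; nonemptiness of the option sets is imposed separately
-- by the predicate 'WellFormed' below.
data Form : Set where
  ∞    : Form
  ∞bar : Form
  ⟨_∣_⟩ : List Form → List Form → Form

data NonEmpty {A : Set} : List A → Set where
  ne : ∀ x xs → NonEmpty (x ∷ xs)

mutual
  data WellFormed : Form → Set where
    wf-∞    : WellFormed ∞
    wf-∞bar : WellFormed ∞bar
    wf-cmp  : ∀ {L R} → NonEmpty L → NonEmpty R →
              AllWF L → AllWF R → WellFormed ⟨ L ∣ R ⟩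

  data AllWF : List Form → Set where
    []  : AllWF []
    _∷_ : ∀ {G Gs} → WellFormed G → AllWF Gs → AllWF (G ∷ Gs)

-- Who wins.  lf G: Left wins G moving first; ls G: Left wins moving second;
-- rf G: Right wins moving first; rs G: Right wins moving second.
mutual
  lf : Form → Bool
  lf ∞ = true
  lf ∞bar = false
  lf ⟨ L ∣ R ⟩ = anyLs L

  ls : Form → Bool
  ls ∞ = true
  ls ∞bar = false
  ls ⟨ L ∣ R ⟩ = allLf R

  rf : Form → Bool
  rf ∞ = false
  rf ∞bar = true
  rf ⟨ L ∣ R ⟩ = anyRs R

  rs : Form → Bool
  rs ∞ = false
  rs ∞bar = true
  rs ⟨ L ∣ R ⟩ = allRf L

  anyLs : List Form → Bool
  anyLs [] = false
  anyLs (G ∷ Gs) = ls G ∨ anyLs Gs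

  allLf : List Form → Bool
  allLf [] = true
  allLf (G ∷ Gs) = lf G ∧ allLf Gs

  anyRs : List Form → Bool
  anyRs [] = false
  anyRs (G ∷ Gs) = rs G ∨ anyRs Gs

  allRf : List Form → Bool
  allRf [] = true
  allRf (G ∷ Gs) = rf G ∧ allRf Gs

data Outcome : Set where
  𝓛 𝓡 𝓝 𝓟 : Outcome

o : Form → Outcome
o G with lf G | ls G | rf G | rs G
... | true  | true  | _     | _     = 𝓛
... | _     | _     | true  | true  = 𝓡
... | true  | _     | true  | _     = 𝓝
... | _     | true  | _     | true  = 𝓟
... | _     | _     | _     | _     = 𝓛   -- unreachable for well-formed forms (determinacy); chosen so as not to help the theorem

mutual
  conj : Form → Form
  conj ∞ = ∞bar
  conj ∞bar = ∞
  conj ⟨ L ∣ R ⟩ = ⟨ conjs R ∣ conjs L ⟩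

  conjs : List Form → List Form
  conjs [] = []
  conjs (G ∷ Gs) = conj G ∷ conjs Gs

data Symmetric : Form → Set where
  sym-cmp : ∀ {L R} →
            (∀ {H} → H ∈ R → ∃[ K ] (K ∈ L × H ≡ conj K)) →
            (∀ {K} → K ∈ L → conj K ∈ R) →
            Symmetric ⟨ L ∣ R ⟩

{-# OPTIONS --safe #-}
module Submission where

-- Conjugation exchanges the players, so in a symmetric form Right's winning
-- first moves are exactly the conjugates of Left's: Left wins moving first
-- iff Right does.  By determinacy a player wins moving second iff the
-- opponent cannot win moving first, so the outcome is 𝓝 when both first
-- players win and 𝓟 when neither does.

open import Defs
open import Data.Bool using (Bool; true; false; not; T; _∧_; _∨_)
open import Data.Empty using (⊥-elim)
open import Data.Bool.ListAction using (any)
open import Data.List using ([]; _∷_)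
open import Data.List.Membership.Propositional using (find; lose)
open import Data.List.Relation.Unary.Any.Properties using (any⁺; any⁻)
open import Data.Product using (_,_)
open import Data.Sum using (_⊎_; inj₁; inj₂)
open import Data.Unit using (tt)
open import Relation.Binary.PropositionalEquality using (_≡_; refl; cong; cong₂; sym; subst)

mutual
  rs∘conj≡ls : ∀ G → rs (conj G) ≡ ls G
  rs∘conj≡ls ∞ = refl
  rs∘conj≡ls ∞bar = refl
  rs∘conj≡ls ⟨ L ∣ R ⟩ = allRf∘conjs≡allLf R

  rf∘conj≡lf : ∀ G → rf (conj G) ≡ lf G
  rf∘conj≡lf ∞ = refl
  rf∘conj≡lf ∞bar = refl
  rf∘conj≡lf ⟨ L ∣ R ⟩ = anyRs∘conjs≡anyLs L

  allRf∘conjs≡allLf : ∀ Gs → allRf (conjs Gs) ≡ allLf Gs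
  allRf∘conjs≡allLf [] = refl
  allRf∘conjs≡allLf (G ∷ Gs) = cong₂ _∧_ (rf∘conj≡lf G) (allRf∘conjs≡allLf Gs)

  anyRs∘conjs≡anyLs : ∀ Gs → anyRs (conjs Gs) ≡ anyLs Gs
  anyRs∘conjs≡anyLs [] = refl
  anyRs∘conjs≡anyLs (G ∷ Gs) = cong₂ _∨_ (rs∘conj≡ls G) (anyRs∘conjs≡anyLs Gs)

mutual
  lf≡not-rs : ∀ G → lf G ≡ not (rs G)
  lf≡not-rs ∞ = refl
  lf≡not-rs ∞bar = refl
  lf≡not-rs ⟨ L ∣ R ⟩ = anyLs≡not-allRf L

  ls≡not-rf : ∀ G → ls G ≡ not (rf G)
  ls≡not-rf ∞ = refl
  ls≡not-rf ∞bar = refl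
  ls≡not-rf ⟨ L ∣ R ⟩ = allLf≡not-anyRs R

  anyLs≡not-allRf : ∀ Gs → anyLs Gs ≡ not (allRf Gs)
  anyLs≡not-allRf [] = refl
  anyLs≡not-allRf (G ∷ Gs)
    rewrite ls≡not-rf G | anyLs≡not-allRf Gs with rf G
  ... | true = refl
  ... | false = refl

  allLf≡not-anyRs : ∀ Gs → allLf Gs ≡ not (anyRs Gs)
  allLf≡not-anyRs [] = refl
  allLf≡not-anyRs (G ∷ Gs)
    rewrite lf≡not-rs G | allLf≡not-anyRs Gs with rs G
  ... | true = refl
  ... | false = refl

lf≡rf⇒𝓝⊎𝓟 : ∀ G → lf G ≡ rf G → (o G ≡ 𝓝) ⊎ (o G ≡ 𝓟)
lf≡rf⇒𝓝⊎𝓟 G lf≡rf with lf G | rf G | ls G | rs G | ls≡not-rf G | lf≡not-rs G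
lf≡rf⇒𝓝⊎𝓟 G refl | true  | true  | false | false | refl | refl = inj₁ refl
lf≡rf⇒𝓝⊎𝓟 G refl | false | false | true  | true  | refl | refl = inj₂ refl

anyLs≡any : ∀ Gs → anyLs Gs ≡ any ls Gs
anyLs≡any [] = refl
anyLs≡any (G ∷ Gs) = cong (ls G ∨_) (anyLs≡any Gs)

anyRs≡any : ∀ Gs → anyRs Gs ≡ any rs Gs
anyRs≡any [] = refl
anyRs≡any (G ∷ Gs) = cong (rs G ∨_) (anyRs≡any Gs)

T-ext : ∀ {x y : Bool} → (T x → T y) → (T y → T x) → x ≡ y
T-ext {true}  {true}  _ _ = refl
T-ext {true}  {false} x⇒y _ = ⊥-elim (x⇒y tt)
T-ext {false} {true}  _ y⇒x = ⊥-elim (y⇒x tt)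
T-ext {false} {false} _ _ = refl

symmetric⇒lf≡rf : ∀ {G} → Symmetric G → lf G ≡ rf G
symmetric⇒lf≡rf {⟨ L ∣ R ⟩} (sym-cmp R⊆conjL conjL⊆R)
  rewrite anyLs≡any L | anyRs≡any R = T-ext left⇒right right⇒left
  where
  left⇒right : T (any ls L) → T (any rs R)
  left⇒right t with find (any⁻ ls L t)
  ... | K , K∈L , lsK = any⁺ rs (lose (conjL⊆R K∈L) (subst T (sym (rs∘conj≡ls K)) lsK))

  right⇒left : T (any rs R) → T (any ls L)
  right⇒left t with find (any⁻ rs R t)
  ... | H , H∈R , rsH with R⊆conjL H∈R
  ... | K , K∈L , refl = any⁺ ls (lose K∈L (subst T (rs∘conj≡ls K) rsH))

theorem3p3 : (G : Form) → WellFormed G → Symmetric G → (o G ≡ 𝓝) ⊎ (o G ≡ 𝓟)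
theorem3p3 G _ symG = lf≡rf⇒𝓝⊎𝓟 G (symmetric⇒lf≡rf symG)
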